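{- Let $q=c/d>0$ be a rational number ($c,d$ positive integers). For every integer $n\geq 2+\left\lfloor\frac{1}{q}\right\rfloor$ there exists a unique pair $(a,b)$ of positive integers such that $a+b=n$ and $1+\left\lfloor\frac{b}{q}\right\rfloor\leq a\leq 1+\left\lfloor\frac{b+1}{q}\right\rfloor$. -}

module Defs where

open import Data.Nat using (ℕ; suc; _+_; _*_; _≤_; NonZero)
open import Data.Nat.DivMod using (_/_)
open import Data.Product using (_×_)
open import Relation.Binary.PropositionalEquality using (_≡_)

-- For q = c / d with c, d positive:  ⌊ x / q ⌋ = ⌊ x * d / c ⌋  for natural x.
floorDivQ : (c d x : ℕ) → .{{NonZero c}} → ℕ
floorDivQ c d x = (x * d) / c

GoodPair : (c d n a b : ℕ) → .{{NonZero c}} → Set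
GoodPair c d n a b =
  1 ≤ a × 1 ≤ b × a + b ≡ n ×
  suc (floorDivQ c d b) ≤ a × a ≤ suc (floorDivQ c d (b + 1))

-- Adding b to both bounds on a turns the condition into b + ⌊b/q⌋ < n ≤ (b+1) + ⌊(b+1)/q⌋,
-- i.e. n lies in the b-th step of the strictly increasing map t(b) = b + ⌊b/q⌋.
-- These steps partition the naturals above t(1), so b, and with it a = n − b, is unique.
module Submission where

open import Defs
open import Data.Nat using (ℕ; zero; suc; _+_; _∸_; _≤_; _<_; NonZero; z≤n; s≤s)
open import Data.Nat.Properties
open import Data.Nat.DivMod using (/-monoˡ-≤)
open import Data.Product using (_×_; _,_; proj₁; ∃-syntax; ∃₂)
open import Data.Sum using (inj₁; inj₂)
open import Relation.Binary.Core using (_Preserves_⟶_)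
open import Relation.Binary.PropositionalEquality using (_≡_; refl; sym; trans; cong; cong₂; subst)

Brackets : (ℕ → ℕ) → ℕ → ℕ → Set
Brackets h b n = h b < n × n ≤ h (suc b)

module _ {h : ℕ → ℕ} where

  brackets-exists : (∀ x → h x < h (suc x)) → ∀ {k} n → h k < n → ∃[ b ] Brackets h b n
  brackets-exists step zero ()
  brackets-exists step {k} (suc n) hk<1+n with m≤n⇒m<n∨m≡n (≤-pred hk<1+n)
  ... | inj₂ refl = k , ≤-refl , step k
  ... | inj₁ hk<n with brackets-exists step n hk<n
  ...   | b , hb<n , n≤hb+1 with m≤n⇒m<n∨m≡n n≤hb+1
  ...     | inj₁ n<hb+1 = b , m<n⇒m<1+n hb<n , n<hb+1
  ...     | inj₂ refl = suc b , ≤-refl , step (suc b)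

  brackets-lowerBound : h Preserves _≤_ ⟶ _≤_ → ∀ {k b n} → h k < n → Brackets h b n → k ≤ b
  brackets-lowerBound mono hk<n (_ , n≤hb+1) =
    ≮⇒≥ λ b<k → <⇒≱ hk<n (≤-trans n≤hb+1 (mono b<k))

  brackets-unique : h Preserves _≤_ ⟶ _≤_ → ∀ {b b′ n} → Brackets h b n → Brackets h b′ n → b ≡ b′
  brackets-unique mono br br′ =
    ≤-antisym (brackets-lowerBound mono (proj₁ br) br′) (brackets-lowerBound mono (proj₁ br′) br)

module _ (c d : ℕ) .{{_ : NonZero c}} where

  threshold : ℕ → ℕ
  threshold b = b + floorDivQ c d b

  floorDivQ-mono : (λ x → floorDivQ c d x) Preserves _≤_ ⟶ _≤_
  floorDivQ-mono x≤y = /-monoˡ-≤ c (*-monoˡ-≤ d x≤y)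

  threshold-mono : threshold Preserves _≤_ ⟶ _≤_
  threshold-mono x≤y = +-mono-≤ x≤y (floorDivQ-mono x≤y)

  threshold-step : ∀ x → threshold x < threshold (suc x)
  threshold-step x = s≤s (+-monoʳ-≤ x (floorDivQ-mono (n≤1+n x)))

  lowerBound-shift : ∀ b → suc (floorDivQ c d b) + b ≡ suc (threshold b)
  lowerBound-shift b = cong suc (+-comm (floorDivQ c d b) b)

  upperBound-shift : ∀ b → suc (floorDivQ c d (b + 1)) + b ≡ threshold (suc b)
  upperBound-shift b rewrite +-comm b 1 = cong suc (+-comm (floorDivQ c d (suc b)) b)

  bounds⇒brackets : ∀ {a b} → suc (floorDivQ c d b) ≤ a → a ≤ suc (floorDivQ c d (b + 1)) →
                    Brackets threshold b (a + b)
  bounds⇒brackets {a} {b} lower upper =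
    subst (_≤ a + b) (lowerBound-shift b) (+-monoˡ-≤ b lower) ,
    subst (a + b ≤_) (upperBound-shift b) (+-monoˡ-≤ b upper)

  brackets⇒bounds : ∀ {a b} → Brackets threshold b (a + b) →
                    suc (floorDivQ c d b) ≤ a × a ≤ suc (floorDivQ c d (b + 1))
  brackets⇒bounds {a} {b} (lower , upper) =
    +-cancelʳ-≤ b _ _ (subst (_≤ a + b) (sym (lowerBound-shift b)) lower) ,
    +-cancelʳ-≤ b _ _ (subst (a + b ≤_) (sym (upperBound-shift b)) upper)

  goodPair⇒brackets : ∀ {n a b} → GoodPair c d n a b → Brackets threshold b n
  goodPair⇒brackets (_ , _ , refl , lower , upper) = bounds⇒brackets lower upper

  brackets⇒goodPair : ∀ {n b} → 1 ≤ b → Brackets threshold b n → GoodPair c d n (n ∸ b) b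
  brackets⇒goodPair {n} {b} 1≤b br@(t<n , _) =
    ≤-trans (s≤s z≤n) (proj₁ bounds) , 1≤b , a+b≡n , bounds
    where
    a+b≡n : n ∸ b + b ≡ n
    a+b≡n = m∸n+n≡m (≤-trans (m≤m+n b _) (<⇒≤ t<n))

    bounds : suc (floorDivQ c d b) ≤ n ∸ b × n ∸ b ≤ suc (floorDivQ c d (b + 1))
    bounds = brackets⇒bounds (subst (Brackets threshold b) (sym a+b≡n) br)

mainTheorem14 : (c d : ℕ) → .{{_ : NonZero c}} → .{{_ : NonZero d}} →
    (n : ℕ) → 2 + floorDivQ c d 1 ≤ n →
    ∃₂ λ a b → GoodPair c d n a b ×
      ((a′ b′ : ℕ) → GoodPair c d n a′ b′ → a′ ≡ a × b′ ≡ b)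
mainTheorem14 c d n t₁<n with brackets-exists (threshold-step c d) {1} n t₁<n
... | b , br = n ∸ b , b , brackets⇒goodPair c d 1≤b br , unique
  where
  1≤b : 1 ≤ b
  1≤b = brackets-lowerBound (threshold-mono c d) t₁<n br

  unique : (a′ b′ : ℕ) → GoodPair c d n a′ b′ → a′ ≡ n ∸ b × b′ ≡ b
  unique a′ b′ gp@(_ , _ , a′+b′≡n , _) =
    trans (sym (m+n∸n≡m a′ b′)) (cong₂ _∸_ a′+b′≡n b′≡b) , b′≡b
    where
    b′≡b : b′ ≡ b
    b′≡b = brackets-unique (threshold-mono c d) (goodPair⇒brackets c d gp) br
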